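{- Let $H$ be a good homogeneous relation on a finite set $X$. Then the family of homogeneous modules of $H$ is weakly partitive.
   Context: A diverse triple of a finite set $X$ is a triple $(x,y,z)\in X^3$ with $x\neq y$ and $x\neq z$, written $(x|yz)$. A homogeneous relation $H$ on $X$ is a relation on diverse triples such that for every $x\in X$ the relation $H_x(y,z)\Leftrightarrow H(x|yz)$ is an equivalence relation on $X\setminus\{x\}$. A subset $M\subseteq X$ is a homogeneous module of $H$ if $H(x|mm')$ for all $m,m'\in M$ and all $x\in X\setminus M$. $H$ is good (modular quotient) if for every homogeneous module $M$, all $x,y\in M$ and all $s,t\notin M$, $H(x|st)\Leftrightarrow H(y|st)$. Sets $A,B$ overlap if $A\cap B$, $A\setminus B$, $B\setminus A$ are all non-empty. A family $\mathcal F$ of subsets of $X$ is weakly partitive if it contains $X$ and all singletons, and for all overlapping $A,B\in\mathcal F$, the sets $A\cap B$, $A\cup B$ and $A\setminus B$ belong to $\mathcal F$. -}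

module Defs where

open import Data.Nat using (ℕ)
open import Data.Fin using (Fin)
open import Data.Fin.Subset using (Subset; _∈_; _∉_; _∩_; _∪_; _─_; ⊤; ⁅_⁆; Nonempty)
open import Data.Product using (_×_)
open import Relation.Binary.PropositionalEquality using (_≢_)
open import Function.Bundles using (_⇔_)

-- A ternary relation on X = Fin n; R x y z stands for (x|yz).
TernRel : ℕ → Set₁
TernRel n = Fin n → Fin n → Fin n → Set

record IsHomogeneous {n : ℕ} (H : TernRel n) : Set where
  field
    diverse : ∀ {x y z} → H x y z → (x ≢ y) × (x ≢ z)
    refl    : ∀ {x y} → x ≢ y → H x y y
    sym     : ∀ {x y z} → H x y z → H x z y
    trans   : ∀ {x y z w} → H x y z → H x z w → H x y w

IsModule : {n : ℕ} → TernRel n → Subset n → Set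
IsModule H M = ∀ x m m′ → m ∈ M → m′ ∈ M → x ∉ M → H x m m′

IsGood : {n : ℕ} → TernRel n → Set
IsGood {n} H = ∀ (M : Subset n) → IsModule H M →
  ∀ x y s t → x ∈ M → y ∈ M → s ∉ M → t ∉ M → (H x s t ⇔ H y s t)

Overlap : {n : ℕ} → Subset n → Subset n → Set
Overlap A B = Nonempty (A ∩ B) × Nonempty (A ─ B) × Nonempty (B ─ A)

record IsWeaklyPartitive {n : ℕ} (F : Subset n → Set) : Set where
  field
    full       : F ⊤
    singletons : ∀ x → F ⁅ x ⁆
    closed-∩   : ∀ A B → F A → F B → Overlap A B → F (A ∩ B)
    closed-∪   : ∀ A B → F A → F B → Overlap A B → F (A ∪ B)
    closed-─   : ∀ A B → F A → F B → Overlap A B → F (A ─ B)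

module Submission where

open import Defs
open import Data.Nat using (ℕ)
open import Data.Fin using (Fin)
open import Data.Fin.Subset
open import Data.Fin.Subset.Properties
open import Data.Vec using (_∷_; here; there)
open import Data.Bool using (true; false)
open import Data.Product using (_,_; proj₁; proj₂)
open import Data.Sum using (inj₁; inj₂)
open import Data.Empty using (⊥-elim)
open import Relation.Nullary using (yes; no)
open import Relation.Binary.PropositionalEquality using (refl)
open import Function.Bundles using (Equivalence)

-- Closure under ∩ and ∪ needs only that each H_x is an equivalence relation.
-- For A ∖ B, an outside point x ∈ A ∩ B sees A ∖ B through a witness
-- d ∈ B ∖ A: d lies outside A, so H(d|mm′), and goodness of the module B
-- transfers this from d to x.

private
  variable
    n : ℕ

x∈p─q⇒x∉q : ∀ {x : Fin n} (p q : Subset n) → x ∈ p ─ q → x ∉ q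
x∈p─q⇒x∉q (true ∷ p) (false ∷ q) here ()
x∈p─q⇒x∉q (_ ∷ p) (_ ∷ q) (there x∈p─q) (there x∈q) = x∈p─q⇒x∉q p q x∈p─q x∈q

module _ {H : TernRel n} where

  ⊤-isModule : IsModule H ⊤
  ⊤-isModule x _ _ _ _ x∉⊤ = ⊥-elim (x∉⊤ ∈⊤)

  ⁅⁆-isModule : IsHomogeneous H → ∀ a → IsModule H ⁅ a ⁆
  ⁅⁆-isModule hom a x m m′ m∈ m′∈ x∉
    with x∈⁅y⁆⇒x≡y a m∈ | x∈⁅y⁆⇒x≡y a m′∈
  ... | refl | refl = IsHomogeneous.refl hom (λ { refl → x∉ m∈ })

  ∩-isModule : ∀ {A B} → IsModule H A → IsModule H B → IsModule H (A ∩ B)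
  ∩-isModule {A} {B} mA mB x m m′ m∈ m′∈ x∉ with x ∈? A | x ∈? B
  ... | no x∉A | _      = mA x m m′ (proj₁ (x∈p∩q⁻ A B m∈)) (proj₁ (x∈p∩q⁻ A B m′∈)) x∉A
  ... | yes _  | no x∉B = mB x m m′ (proj₂ (x∈p∩q⁻ A B m∈)) (proj₂ (x∈p∩q⁻ A B m′∈)) x∉B
  ... | yes xA | yes xB = ⊥-elim (x∉ (x∈p∩q⁺ (xA , xB)))

  ∪-isModule : IsHomogeneous H → ∀ {A B} → IsModule H A → IsModule H B →
               Nonempty (A ∩ B) → IsModule H (A ∪ B)
  ∪-isModule hom {A} {B} mA mB (c , c∈A∩B) x m m′ m∈ m′∈ x∉ =
    trans (relatedToC m m∈) (sym (relatedToC m′ m′∈))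
    where
    open IsHomogeneous hom using (sym; trans)
    relatedToC : ∀ y → y ∈ A ∪ B → H x y c
    relatedToC y y∈ with x∈p∪q⁻ A B y∈
    ... | inj₁ yA = mA x y c yA (proj₁ (x∈p∩q⁻ A B c∈A∩B)) (λ xA → x∉ (x∈p∪q⁺ (inj₁ xA)))
    ... | inj₂ yB = mB x y c yB (proj₂ (x∈p∩q⁻ A B c∈A∩B)) (λ xB → x∉ (x∈p∪q⁺ (inj₂ xB)))

  ─-isModule : IsGood H → ∀ {A B} → IsModule H A → IsModule H B →
               Nonempty (B ─ A) → IsModule H (A ─ B)
  ─-isModule good {A} {B} mA mB (d , d∈B─A) x m m′ m∈ m′∈ x∉ with x ∈? A
  ... | no x∉A = mA x m m′ (p─q⊆p A B m∈) (p─q⊆p A B m′∈) x∉A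
  ... | yes xA with x ∈? B
  ... | no x∉B = ⊥-elim (x∉ (x∈p∧x∉q⇒x∈p─q xA x∉B))
  ... | yes xB = Equivalence.from
        (good B mB x d m m′ xB (p─q⊆p B A d∈B─A) (x∈p─q⇒x∉q A B m∈) (x∈p─q⇒x∉q A B m′∈))
        (mA d m m′ (p─q⊆p A B m∈) (p─q⊆p A B m′∈) (x∈p─q⇒x∉q B A d∈B─A))

proposition15 : (n : ℕ) (H : TernRel n) → IsHomogeneous H → IsGood H →
    IsWeaklyPartitive (IsModule H)
proposition15 n H hom good = record
  { full       = ⊤-isModule
  ; singletons = ⁅⁆-isModule hom
  ; closed-∩   = λ _ _ mA mB _ → ∩-isModule mA mB
  ; closed-∪   = λ _ _ mA mB (A∩B≠∅ , _) → ∪-isModule hom mA mB A∩B≠∅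
  ; closed-─   = λ _ _ mA mB (_ , _ , B─A≠∅) → ─-isModule good mA mB B─A≠∅
  }
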